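{- Let $G$ be any group and let $S$ be any subset of $G$. Then the fusion set $F_S$ of $S$ with respect to $(A_G,\prec)$ is \[ F_S=\{\chi_{\langle R\rangle} \mid R\subseteq S\}, \] i.e. it consists of the characteristic functions of the subgroups generated by all subsets of $S$, with the convention $\langle\emptyset\rangle=\{e\}$.
   Context: For a group $G$ and a subgroup $H$, let $\chi_H\colon G\to\{0,1\}$ be the characteristic function of $H$. Let $(A_G,\prec)$ be the set of characteristic functions of all subgroups of $G$, partially ordered by $\chi_H\prec\chi_K$ iff $H\subseteq K$. For $S\subseteq G$ and $f\in A_G$, $f$ is Occam on $S$ if $f$ is the least element (with respect to $\prec$) of $\{g\in A_G \mid g|_S=f|_S\}$. The fusion set $F_S$ of $S$ is the set of all $f\in A_G$ that are Occam on $S$. -}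

module Defs where

open import Level using (Level; _⊔_; suc)
open import Algebra.Bundles using (Group)
open import Data.Product using (_×_; _,_; Σ)
open import Relation.Unary using (Pred; _⊆_)

module _ {c ℓ : Level} (G : Group c ℓ) where
  open Group G

  Subset : Set (suc (c ⊔ ℓ))
  Subset = Pred Carrier (c ⊔ ℓ)

  -- A subgroup of G, given by its membership predicate
  -- (equivalently: its characteristic function G → {0,1}).
  record Subgroup : Set (suc (c ⊔ ℓ)) where
    field
      mem   : Subset
      resp  : ∀ {x y} → x ≈ y → mem x → mem y
      ε∈    : mem ε
      ∙∈    : ∀ {x y} → mem x → mem y → mem (x ∙ y)
      ⁻¹∈   : ∀ {x} → mem x → mem (x ⁻¹)
  open Subgroup public

  _≺_ : Subgroup → Subgroup → Set (c ⊔ ℓ)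
  H ≺ K = mem H ⊆ mem K

  _≐_ : Subgroup → Subgroup → Set (c ⊔ ℓ)
  H ≐ K = (mem H ⊆ mem K) × (mem K ⊆ mem H)

  AgreeOn : Subset → Subgroup → Subgroup → Set (c ⊔ ℓ)
  AgreeOn S H K = ∀ {s} → S s → (mem H s → mem K s) × (mem K s → mem H s)

  Occam : Subset → Subgroup → Set (suc (c ⊔ ℓ))
  Occam S H = AgreeOn S H H × (∀ (K : Subgroup) → AgreeOn S K H → H ≺ K)

  -- The subgroup ⟨R⟩ generated by R: the inductive closure of R under
  -- ε, _∙_, _⁻¹ and ≈.  In particular ⟨∅⟩ = {e} (up to ≈).
  data Gen (R : Subset) : Carrier → Set (c ⊔ ℓ) where
    gen  : ∀ {x} → R x → Gen R x
    unit : Gen R ε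
    mul  : ∀ {x y} → Gen R x → Gen R y → Gen R (x ∙ y)
    inv  : ∀ {x} → Gen R x → Gen R (x ⁻¹)
    cong≈ : ∀ {x y} → x ≈ y → Gen R x → Gen R y

  ⟨_⟩ : Subset → Subgroup
  ⟨ R ⟩ = record { mem = Gen R ; resp = cong≈ ; ε∈ = unit ; ∙∈ = mul ; ⁻¹∈ = inv }

  FusionSetIsGenerated : Subset → Set (suc (c ⊔ ℓ))
  FusionSetIsGenerated S =
    (∀ (H : Subgroup) → Occam S H → Σ Subset (λ R → (R ⊆ S) × (H ≐ ⟨ R ⟩)))
    × (∀ (R : Subset) → R ⊆ S → Occam S ⟨ R ⟩)

-- A subgroup H that is Occam on S is recovered from its trace S ∩ H:
-- ⟨S ∩ H⟩ ⊆ H, and ⟨S ∩ H⟩ agrees with H on S, so minimality of H gives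
-- H ⊆ ⟨S ∩ H⟩.  Conversely, for R ⊆ S any subgroup agreeing with ⟨R⟩ on S
-- contains R, hence contains ⟨R⟩.
module Submission where

open import Defs
open import Level using (Level)
open import Algebra.Bundles using (Group)
open import Data.Product using (_,_; proj₁; proj₂)
open import Function using (id)
open import Relation.Unary using (_⊆_; _∩_)

module _ {c ℓ : Level} (G : Group c ℓ) where

  ⟨⟩-least : {R : Subset G} (K : Subgroup G) → R ⊆ mem K → _≺_ G (⟨_⟩ G R) K
  ⟨⟩-least K R⊆K (gen r)      = R⊆K r
  ⟨⟩-least K R⊆K unit         = ε∈ K
  ⟨⟩-least K R⊆K (mul a b)    = ∙∈ K (⟨⟩-least K R⊆K a) (⟨⟩-least K R⊆K b)
  ⟨⟩-least K R⊆K (inv a)      = ⁻¹∈ K (⟨⟩-least K R⊆K a)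
  ⟨⟩-least K R⊆K (cong≈ e a)  = resp K e (⟨⟩-least K R⊆K a)

  ⟨∩⟩-agreeOn : {S : Subset G} (H : Subgroup G) → AgreeOn G S (⟨_⟩ G (S ∩ mem H)) H
  ⟨∩⟩-agreeOn H s∈S = ⟨⟩-least H proj₂ , λ s∈H → gen (s∈S , s∈H)

  occam⇒≐⟨∩⟩ : {S : Subset G} (H : Subgroup G) → Occam G S H → _≐_ G H (⟨_⟩ G (S ∩ mem H))
  occam⇒≐⟨∩⟩ H (_ , least) =
    least (⟨_⟩ G _) (⟨∩⟩-agreeOn H) , ⟨⟩-least H proj₂

  ⟨⟩-occam : {S R : Subset G} → R ⊆ S → Occam G S (⟨_⟩ G R)
  ⟨⟩-occam R⊆S = (λ _ → id , id) , λ K K~⟨R⟩ →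
    ⟨⟩-least K (λ r∈R → proj₂ (K~⟨R⟩ (R⊆S r∈R)) (gen r∈R))

theorem3p1 : {c ℓ : Level} (G : Group c ℓ) (S : Subset G) → FusionSetIsGenerated G S
theorem3p1 G S =
  (λ H occam → S ∩ mem H , proj₁ , occam⇒≐⟨∩⟩ G {S} H occam) ,
  (λ R R⊆S → ⟨⟩-occam G R⊆S)
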